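{- Let $w\in\{\mathtt{0},\mathtt{1}\}^*$ be an overlap-free word of length at least $10$, and write $w=w'w''$ with $|w'|,|w''|\geq 5$. Then for every letter $a\in\{\mathtt{0},\mathtt{1}\}$, the word $w'aw''$ contains an overlap of period at most $3$ (and hence a factor of exponent at least $7/3$).
   Context: An overlap is a word of the form $axaxa$ with $a$ a letter and $x$ a possibly empty word; its period is $|ax|$. A word is overlap-free if it has no overlap as a factor. The exponent of a word is its length divided by its minimal period. -}

module Defs where

open import Data.Bool using (Bool)
open import Data.List using (List; _∷_; []; _++_; length)
open import Data.Nat using (ℕ; suc)
open import Data.Product using (Σ; _×_; ∃)
open import Relation.Binary.PropositionalEquality using (_≡_)
open import Relation.Nullary using (¬_)

Word : Set
Word = List Bool

Factor : Word → Word → Set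
Factor f w = Σ Word λ u → Σ Word λ v → w ≡ u ++ f ++ v

overlapWord : Bool → Word → Word
overlapWord a x = a ∷ x ++ a ∷ x ++ a ∷ []

HasOverlapOfPeriod : ℕ → Word → Set
HasOverlapOfPeriod p w =
  Σ Bool λ a → Σ Word λ x → (suc (length x) ≡ p) × Factor (overlapWord a x) w

HasOverlap : Word → Set
HasOverlap w = Σ ℕ λ p → HasOverlapOfPeriod p w

OverlapFree : Word → Set
OverlapFree w = ¬ HasOverlap w

module Submission where

-- Overlap-freeness and overlaps are local: inserting a letter
-- a between w' and w'' only affects the window formed by the last five
-- letters s of w' and the first five letters t of w''.  An exhaustive
-- check over all 2^11 choices of (s, a, t) shows that in every case either
-- s a t contains an overlap of period at most 3, or s t already contains an
-- overlap (necessarily of period at most 4, since |s t| = 10).  In the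
-- first case the overlap persists in w' a w'', which has s a t as a factor;
-- the second case is impossible, because s t is a factor of the
-- overlap-free word w' w''.

open import Defs
open import Data.Bool using (Bool; true; false; T; _∧_)
open import Data.Bool.Properties using (T-∧) renaming (_≟_ to _≟ᵇ_)
open import Data.List using (_∷_; []; _++_; length; take; drop)
open import Data.List.Properties using (++-assoc; take++drop≡id; length-take; length-drop)
open import Data.Maybe using (Maybe; just; nothing; is-just; map; _<∣>_)
open import Data.Nat using (ℕ; zero; suc; _≤_; _∸_)
open import Data.Nat.Properties using (_≟_; ≤-refl; m≤n⇒m≤1+n; m≤n⇒m⊓n≡m; m∸[m∸n]≡n)
open import Data.Product using (Σ; _×_; _,_; proj₁; proj₂)
open import Data.Sum using (_⊎_; inj₁; inj₂)
open import Data.Unit using (tt)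
open import Data.Empty using (⊥-elim)
open import Function using (_∘_)
open import Function.Bundles using (Equivalence)
open import Relation.Binary.PropositionalEquality using (_≡_; refl; sym; trans; cong; subst; module ≡-Reasoning)
open import Relation.Nullary using (yes; no)

OverlapOfPeriodAtMost : ℕ → Word → Set
OverlapOfPeriodAtMost n w = Σ ℕ λ p → (p ≤ n) × HasOverlapOfPeriod p w

StartsWithOverlap : ℕ → Word → Set
StartsWithOverlap p w =
  Σ Bool λ a → Σ Word λ x → (suc (length x) ≡ p) × Σ Word λ v → w ≡ overlapWord a x ++ v

factor-++ˡ : ∀ {f w} (u : Word) → Factor f w → Factor f (u ++ w)
factor-++ˡ {f} u (x , y , refl) = u ++ x , y , sym (++-assoc u x (f ++ y))

factor-++ʳ : ∀ {f w} (v : Word) → Factor f w → Factor f (w ++ v)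
factor-++ʳ {f} v (x , y , refl) = x , y ++ v , regroup
  where
    open ≡-Reasoning
    regroup : (x ++ f ++ y) ++ v ≡ x ++ f ++ y ++ v
    regroup = begin
      (x ++ f ++ y) ++ v  ≡⟨ ++-assoc x (f ++ y) v ⟩
      x ++ (f ++ y) ++ v  ≡⟨ cong (x ++_) (++-assoc f y v) ⟩
      x ++ f ++ y ++ v    ∎

overlap-infix : ∀ {p w} (u v : Word) → HasOverlapOfPeriod p w → HasOverlapOfPeriod p (u ++ w ++ v)
overlap-infix u v (a , x , period , fac) = a , x , period , factor-++ˡ u (factor-++ʳ v fac)

insertion-regroup : (u s m t v : Word) → (u ++ s) ++ m ++ t ++ v ≡ u ++ (s ++ m ++ t) ++ v
insertion-regroup u s m t v = begin
    (u ++ s) ++ m ++ t ++ v    ≡⟨ ++-assoc u s (m ++ t ++ v) ⟩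
    u ++ s ++ m ++ t ++ v      ≡⟨ cong (λ z → u ++ s ++ z) (sym (++-assoc m t v)) ⟩
    u ++ s ++ (m ++ t) ++ v    ≡⟨ cong (u ++_) (sym (++-assoc s (m ++ t) v)) ⟩
    u ++ (s ++ m ++ t) ++ v    ∎
  where open ≡-Reasoning

prefix? : (f w : Word) → Maybe (Σ Word λ v → w ≡ f ++ v)
prefix? [] w = just (w , refl)
prefix? (_ ∷ _) [] = nothing
prefix? (b ∷ f) (c ∷ w) with b ≟ᵇ c | prefix? f w
... | yes refl | just (v , w≡f++v) = just (v , cong (b ∷_) w≡f++v)
... | _        | _                 = nothing

-- A word a ∷ w can only start with the overlap a x a x a where x = take (p - 1) w.
startsWithOverlap? : (p : ℕ) (w : Word) → Maybe (StartsWithOverlap p w)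
startsWithOverlap? zero _ = nothing
startsWithOverlap? (suc k) [] = nothing
startsWithOverlap? (suc k) (a ∷ w) with length (take k w) ≟ k | prefix? (overlapWord a (take k w)) (a ∷ w)
... | yes |x|≡k | just (v , eq) = just (a , take k w , cong suc |x|≡k , v , eq)
... | _         | _             = nothing

overlapOfPeriod? : (p : ℕ) (w : Word) → Maybe (HasOverlapOfPeriod p w)
overlapOfPeriod? p [] = nothing
overlapOfPeriod? p (b ∷ w) = map atStart (startsWithOverlap? p (b ∷ w)) <∣> map later (overlapOfPeriod? p w)
  where
    atStart : StartsWithOverlap p (b ∷ w) → HasOverlapOfPeriod p (b ∷ w)
    atStart (a , x , period , v , eq) = a , x , period , [] , v , eq
    later : HasOverlapOfPeriod p w → HasOverlapOfPeriod p (b ∷ w)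
    later (a , x , period , u , v , eq) = a , x , period , b ∷ u , v , cong (b ∷_) eq

-- Try every period 1 ≤ p ≤ n (overlaps have positive period).
overlapOfPeriodAtMost? : (n : ℕ) (w : Word) → Maybe (OverlapOfPeriodAtMost n w)
overlapOfPeriodAtMost? zero w = nothing
overlapOfPeriodAtMost? (suc n) w =
  map (λ ov → suc n , ≤-refl , ov) (overlapOfPeriod? (suc n) w)
  <∣> map (λ (p , p≤n , ov) → p , m≤n⇒m≤1+n p≤n , ov) (overlapOfPeriodAtMost? n w)

fromJust : {A : Set} (m : Maybe A) → T (is-just m) → A
fromJust (just x) _ = x

everyWord : ℕ → (Word → Bool) → Bool
everyWord zero f = f []
everyWord (suc n) f = everyWord n (f ∘ (true ∷_)) ∧ everyWord n (f ∘ (false ∷_))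

everyWord-sound : ∀ n f → T (everyWord n f) → (l : Word) → length l ≡ n → T (f l)
everyWord-sound zero f holds [] refl = holds
everyWord-sound (suc n) f holds (true ∷ l) refl =
  everyWord-sound n (f ∘ (true ∷_)) (proj₁ (Equivalence.to (T-∧ {everyWord n _}) holds)) l refl
everyWord-sound (suc n) f holds (false ∷ l) refl =
  everyWord-sound n (f ∘ (false ∷_)) (proj₂ (Equivalence.to (T-∧ {everyWord n _}) holds)) l refl

everyLetter : (Bool → Bool) → Bool
everyLetter f = f true ∧ f false

everyLetter-sound : ∀ f → T (everyLetter f) → (a : Bool) → T (f a)
everyLetter-sound f holds true = proj₁ (Equivalence.to (T-∧ {f true}) holds)
everyLetter-sound f holds false = proj₂ (Equivalence.to (T-∧ {f true}) holds)

WindowOutcome : Word → Bool → Word → Set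
WindowOutcome s a t = OverlapOfPeriodAtMost 3 (s ++ a ∷ t) ⊎ HasOverlap (s ++ t)

window? : (s : Word) (a : Bool) (t : Word) → Maybe (WindowOutcome s a t)
window? s a t =
  map inj₁ (overlapOfPeriodAtMost? 3 (s ++ a ∷ t))
  <∣> map (λ (p , _ , ov) → inj₂ (p , ov)) (overlapOfPeriodAtMost? 4 (s ++ t))

-- The search succeeds on all 2^11 windows; verified by evaluation.
windowSucceeds : Word → Word → Bool → Bool
windowSucceeds s t a = is-just (window? s a t)

window?-succeeds : T (everyWord 5 λ s → everyWord 5 (everyLetter ∘ windowSucceeds s))
window?-succeeds = tt

window : (s t : Word) → length s ≡ 5 → length t ≡ 5 → (a : Bool) → WindowOutcome s a t
window s t |s|≡5 |t|≡5 a = fromJust (window? s a t) succeeds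
  where
    succeeds : T (windowSucceeds s t a)
    succeeds =
      everyLetter-sound (windowSucceeds s t)
        (everyWord-sound 5 (everyLetter ∘ windowSucceeds s)
          (everyWord-sound 5 (λ s → everyWord 5 (everyLetter ∘ windowSucceeds s)) window?-succeeds s |s|≡5)
          t |t|≡5)
        a

prefixOfLength : (n : ℕ) (w : Word) → n ≤ length w →
  Σ Word λ t → Σ Word λ v → (w ≡ t ++ v) × (length t ≡ n)
prefixOfLength n w n≤|w| =
  take n w , drop n w , sym (take++drop≡id n w) , trans (length-take n w) (m≤n⇒m⊓n≡m n≤|w|)

suffixOfLength : (n : ℕ) (w : Word) → n ≤ length w →
  Σ Word λ u → Σ Word λ s → (w ≡ u ++ s) × (length s ≡ n)
suffixOfLength n w n≤|w| =
  take k w , drop k w , sym (take++drop≡id k w) , trans (length-drop k w) (m∸[m∸n]≡n n≤|w|)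
  where
    k = length w ∸ n

lemma2p1 : (w' w'' : Word) → OverlapFree (w' ++ w'') →
    5 ≤ length w' → 5 ≤ length w'' →
    (a : Bool) →
    Σ ℕ λ p → (p ≤ 3) × HasOverlapOfPeriod p (w' ++ a ∷ w'')
lemma2p1 w' w'' overlapFree 5≤|w'| 5≤|w''| a
  with suffixOfLength 5 w' 5≤|w'| | prefixOfLength 5 w'' 5≤|w''|
... | u , s , refl , |s|≡5 | t , v , refl , |t|≡5
  with window s t |s|≡5 |t|≡5 a
... | inj₁ (p , p≤3 , ov) =
  p , p≤3 , subst (HasOverlapOfPeriod p) (sym (insertion-regroup u s (a ∷ []) t v)) (overlap-infix u v ov)
... | inj₂ (p , ov) =
  ⊥-elim (overlapFree (p , subst (HasOverlapOfPeriod p) (sym (insertion-regroup u s [] t v)) (overlap-infix u v ov)))
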